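{- Let $\mathcal{Q}$ be a seminormal quasi-crystal with underlying set $Q$, and let $u,v\in Q^*$ be such that $uv$ is an isolated element of $\mathcal{Q}^{*}$. Then $uvw\ \ddot{\sim}\ uwv\ \ddot{\sim}\ wuv$ for every $w\in Q^*$.
   Context: Root system data: $V$ a finite-dimensional real inner product space, $\alpha^\vee=\frac{2}{\langle\alpha,\alpha\rangle}\alpha$; a root system $\Phi$ with fixed simple roots $(\alpha_i)_{i\in I}$ and weight lattice $\Lambda$ (a $\mathbb{Z}$-submodule of $V$ spanning $V$, containing $\Phi$, with $\langle\lambda,\alpha^\vee\rangle\in\mathbb{Z}$ for $\alpha\in\Phi$). A quasi-crystal of type $\Phi$ is a set $Q$ with maps $\mathrm{wt}:Q\to\Lambda$, $\ddot{e}_i,\ddot{f}_i:Q\to Q\sqcup\{\bot\}$ ($\bot$ = undefined), $\ddot{\varepsilon}_i,\ddot{\varphi}_i:Q\to\mathbb{Z}\cup\{\pm\infty\}$ ($i\in I$) such that: $\ddot{\varphi}_i(x)=\ddot{\varepsilon}_i(x)+\langle\mathrm{wt}(x),\alpha_i^\vee\rangle$ (with $m+(\pm\infty)=\pm\infty$); if $\ddot{e}_i(x)\in Q$ then $\mathrm{wt}(\ddot{e}_i(x))=\mathrm{wt}(x)+\alpha_i$, $\ddot{\varepsilon}_i(\ddot{e}_i(x))=\ddot{\varepsilon}_i(x)-1$, $\ddot{\varphi}_i(\ddot{e}_i(x))=\ddot{\varphi}_i(x)+1$; if $\ddot{f}_i(x)\in Q$ then $\mathrm{wt}(\ddot{f}_i(x))=\mathrm{wt}(x)-\alpha_i$,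 $\ddot{\varepsilon}_i(\ddot{f}_i(x))=\ddot{\varepsilon}_i(x)+1$, $\ddot{\varphi}_i(\ddot{f}_i(x))=\ddot{\varphi}_i(x)-1$; $\ddot{e}_i(x)=y\iff x=\ddot{f}_i(y)$; $\ddot{\varepsilon}_i(x)=\pm\infty$ implies $\ddot{e}_i(x)=\ddot{f}_i(x)=\bot$. Seminormal: whenever $\ddot{\varepsilon}_i(x)\ne+\infty$, $\ddot{\varepsilon}_i(x)=\max\{k\ge0:\ddot{e}_i^k(x)\in Q\}$ and $\ddot{\varphi}_i(x)=\max\{k\ge0:\ddot{f}_i^k(x)\in Q\}$. A quasi-crystal isomorphism between quasi-crystals with underlying sets $X,Y$ is a bijection $\psi:X\to Y$ preserving $\mathrm{wt},\ddot{\varepsilon}_i,\ddot{\varphi}_i$ such that $\ddot{e}_i(\psi(x))$ is defined iff $\ddot{e}_i(x)$ is, and then $\psi(\ddot{e}_i(x))=\ddot{e}_i(\psi(x))$; likewise for $\ddot{f}_i$. The free quasi-crystal monoid $\mathcal{Q}^{*}$: words over $Q$ with: for the empty word, $\mathrm{wt}=0$, $\ddot{\varepsilon}_i=\ddot{\varphi}_i=0$, $\ddot{e}_i,\ddot{f}_i$ undefined; for $w=x_1\cdots x_m$ ($m\ge1$), $\mathrm{wt}(w)=\sum_k\mathrm{wt}(x_k)$, and with $p=\max\{k:\ddot{\varepsilon}_i(x_k)>0\}$, $q=\min\{l:\ddot{\varphi}_i(x_l)>0\}$: if some $\ddot{\varepsilon}_i(x_k)=+\infty$, or $p,q$ exist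 with $p>q$, then $\ddot{\varepsilon}_i(w)=\ddot{\varphi}_i(w)=+\infty$ and $\ddot{e}_i,\ddot{f}_i$ undefined on $w$; otherwise $\ddot{\varepsilon}_i(w)=\sum_k\ddot{\varepsilon}_i(x_k)$, $\ddot{\varphi}_i(w)=\sum_k\ddot{\varphi}_i(x_k)$, $\ddot{e}_i(w)$ is defined iff $p$ exists and is then $w$ with $x_p$ replaced by $\ddot{e}_i(x_p)$, and $\ddot{f}_i(w)$ is defined iff $q$ exists and is then $w$ with $x_q$ replaced by $\ddot{f}_i(x_q)$. The connected component $Q^*(w)$ is the set of words obtained from $w$ by finitely many (defined) applications of operators $\ddot{e}_i,\ddot{f}_i$, with restricted structure. An element $w$ is isolated if $Q^*(w)=\{w\}$. Hypoplactic congruence: $u\ddot{\sim}v$ iff there is a quasi-crystal isomorphism $Q^*(u)\to Q^*(v)$ sending $u$ to $v$. -}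

module Defs where

open import Data.Nat using (ℕ; zero; suc; _≤_; _<ᵇ_)
open import Data.Integer as ℤ using (ℤ; +_; -[1+_]; 0ℤ)
open import Data.Fin using (Fin)
open import Data.Vec using (Vec; zipWith; replicate; foldr)
open import Data.List using (List; []; _∷_)
open import Data.Maybe using (Maybe; just; nothing; _>>=_; Is-just)
import Data.Maybe as Maybe
open import Data.Bool using (Bool; true; false; _∨_; _∧_; if_then_else_)
open import Data.Product using (Σ; _×_; _,_)
open import Data.Sum using (_⊎_)
open import Relation.Binary.PropositionalEquality using (_≡_)
open import Relation.Nullary using (¬_)
open import Function.Bundles using (_⇔_)

-- Root datum.  The weight lattice Λ is a ℤ-lattice spanning V, hence
-- free abelian of rank n = dim V; we identify Λ = ℤⁿ (Vec ℤ n).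

record RootDatum : Set where
  field
    n      : ℕ
    r      : ℕ
    simple : Fin r → Vec ℤ n
    coroot : Fin r → Vec ℤ n

  Λ : Set
  Λ = Vec ℤ n

  I : Set
  I = Fin r

  _+Λ_ : Λ → Λ → Λ
  _+Λ_ = zipWith ℤ._+_

  _-Λ_ : Λ → Λ → Λ
  _-Λ_ = zipWith ℤ._-_

  0Λ : Λ
  0Λ = replicate n 0ℤ

  pair : Λ → I → ℤ
  pair l i = foldr (λ _ → ℤ) ℤ._+_ 0ℤ (zipWith ℤ._*_ l (coroot i))

data ℤ∞ : Set where
  fin  : ℤ → ℤ∞
  +∞   : ℤ∞
  -∞   : ℤ∞

_⊞_ : ℤ∞ → ℤ → ℤ∞
fin a ⊞ b = fin (a ℤ.+ b)
+∞    ⊞ _ = +∞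
-∞    ⊞ _ = -∞

-- sum of two elements of ℤ∪{±∞}; only used when no summand is +∞
-- (the value +∞ ⊕ -∞ is never used by the definitions below)
_⊕_ : ℤ∞ → ℤ∞ → ℤ∞
fin a ⊕ fin b = fin (a ℤ.+ b)
fin _ ⊕ +∞    = +∞
fin _ ⊕ -∞    = -∞
+∞    ⊕ _     = +∞
-∞    ⊕ _     = -∞

pos? : ℤ∞ → Bool
pos? (fin (+ zero))    = false
pos? (fin (+ (suc _))) = true
pos? (fin -[1+ _ ])    = false
pos? +∞                = true
pos? -∞                = false

isPlusInf : ℤ∞ → Bool
isPlusInf +∞ = true
isPlusInf _  = false

record QuasiCrystal (D : RootDatum) : Set₁ where
  open RootDatum D
  field
    Q   : Set
    wt  : Q → Λ
    e f : I → Q → Maybe Q          -- nothing = ⊥ (undefined)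
    ε φ : I → Q → ℤ∞
    φ-def   : ∀ i x → φ i x ≡ ε i x ⊞ pair (wt x) i
    e-wt    : ∀ i x y → e i x ≡ just y → wt y ≡ wt x +Λ simple i
    e-ε     : ∀ i x y → e i x ≡ just y → ε i y ≡ ε i x ⊞ -[1+ 0 ]
    e-φ     : ∀ i x y → e i x ≡ just y → φ i y ≡ φ i x ⊞ (+ 1)
    f-wt    : ∀ i x y → f i x ≡ just y → wt y ≡ wt x -Λ simple i
    f-ε     : ∀ i x y → f i x ≡ just y → ε i y ≡ ε i x ⊞ (+ 1)
    f-φ     : ∀ i x y → f i x ≡ just y → φ i y ≡ φ i x ⊞ -[1+ 0 ]
    e⇔f     : ∀ i x y → (e i x ≡ just y) ⇔ (f i y ≡ just x)
    inf-e   : ∀ i x → (ε i x ≡ +∞ ⊎ ε i x ≡ -∞) → e i x ≡ nothing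
    inf-f   : ∀ i x → (ε i x ≡ +∞ ⊎ ε i x ≡ -∞) → f i x ≡ nothing

iter : {A : Set} → ℕ → (A → Maybe A) → A → Maybe A
iter zero    g x = just x
iter (suc k) g x = g x >>= iter k g

IsMaxIter : {A : Set} → (A → Maybe A) → A → ℕ → Set
IsMaxIter g x k = Is-just (iter k g x) × (∀ m → Is-just (iter m g x) → m ≤ k)

module _ {D : RootDatum} (QC : QuasiCrystal D) where
  open RootDatum D
  open QuasiCrystal QC

  Seminormal : Set
  Seminormal = ∀ i x → ¬ (ε i x ≡ +∞) →
      Σ ℕ (λ k → (ε i x ≡ fin (+ k)) × IsMaxIter (e i) x k)
    × Σ ℕ (λ k → (φ i x ≡ fin (+ k)) × IsMaxIter (f i) x k)

  -- The free quasi-crystal monoid Q*  (words = lists, positions from 0)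

  Word : Set
  Word = List Q

  wtW : Word → Λ
  wtW []       = 0Λ
  wtW (x ∷ xs) = wt x +Λ wtW xs

  firstIdx : (Q → Bool) → Word → Maybe ℕ
  firstIdx P []       = nothing
  firstIdx P (x ∷ xs) = if P x then just 0 else Maybe.map suc (firstIdx P xs)

  lastIdx : (Q → Bool) → Word → Maybe ℕ
  lastIdx P []       = nothing
  lastIdx P (x ∷ xs) with lastIdx P xs
  ... | just k  = just (suc k)
  ... | nothing = if P x then just 0 else nothing

  anyB : (Q → Bool) → Word → Bool
  anyB P []       = false
  anyB P (x ∷ xs) = P x ∨ anyB P xs

  pIdx qIdx : I → Word → Maybe ℕ
  pIdx i = lastIdx  (λ x → pos? (ε i x))
  qIdx i = firstIdx (λ x → pos? (φ i x))

  gtM : Maybe ℕ → Maybe ℕ → Bool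
  gtM (just p) (just q) = q <ᵇ p
  gtM _        _        = false

  badW : I → Word → Bool
  badW i w = anyB (λ x → isPlusInf (ε i x)) w ∨ gtM (pIdx i w) (qIdx i w)

  sumε sumφ : I → Word → ℤ∞
  sumε i []       = fin 0ℤ
  sumε i (x ∷ xs) = ε i x ⊕ sumε i xs
  sumφ i []       = fin 0ℤ
  sumφ i (x ∷ xs) = φ i x ⊕ sumφ i xs

  εW φW : I → Word → ℤ∞
  εW i w = if badW i w then +∞ else sumε i w
  φW i w = if badW i w then +∞ else sumφ i w

  updateAt : ℕ → (Q → Maybe Q) → Word → Maybe Word
  updateAt k       g []       = nothing
  updateAt zero    g (x ∷ xs) = Maybe.map (_∷ xs) (g x)
  updateAt (suc k) g (x ∷ xs) = Maybe.map (x ∷_) (updateAt k g xs)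

  eW fW : I → Word → Maybe Word
  eW i w = if badW i w then nothing else (pIdx i w >>= λ p → updateAt p (e i) w)
  fW i w = if badW i w then nothing else (qIdx i w >>= λ q → updateAt q (f i) w)
  -- (for the empty word: badW is false and p, q do not exist, so
  --  wt = 0, ε = φ = 0 and e, f are undefined, as required)

  data Reach (u : Word) : Word → Set where
    here  : Reach u u
    via-e : ∀ {w w'} i → Reach u w → eW i w ≡ just w' → Reach u w'
    via-f : ∀ {w w'} i → Reach u w → fW i w ≡ just w' → Reach u w'

  Isolated : Word → Set
  Isolated u = ∀ w → Reach u w → w ≡ u

  record IsCompIso (u v : Word) (ψ : Word → Word) : Set where
    field
      ψ⁻¹      : Word → Word
      into     : ∀ w → Reach u w → Reach v (ψ w)
      into⁻¹   : ∀ w → Reach v w → Reach u (ψ⁻¹ w)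
      inv-l    : ∀ w → Reach u w → ψ⁻¹ (ψ w) ≡ w
      inv-r    : ∀ w → Reach v w → ψ (ψ⁻¹ w) ≡ w
      base     : ψ u ≡ v
      pres-wt  : ∀ w → Reach u w → wtW (ψ w) ≡ wtW w
      pres-ε   : ∀ i w → Reach u w → εW i (ψ w) ≡ εW i w
      pres-φ   : ∀ i w → Reach u w → φW i (ψ w) ≡ φW i w
      pres-e   : ∀ i w → Reach u w → eW i (ψ w) ≡ Maybe.map ψ (eW i w)
      pres-f   : ∀ i w → Reach u w → fW i (ψ w) ≡ Maybe.map ψ (fW i w)

  _≈h_ : Word → Word → Set
  u ≈h v = Σ (Word → Word) (IsCompIso u v)

-- Fix an index i.  Since uv is isolated and the quasi-crystal is seminormal, one of two things
-- happens.  Either εᵢ(uv) = +∞ (some letter has εᵢ = +∞, or a letter with φᵢ > 0 precedes one with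
-- εᵢ > 0), and this persists in every word containing uv as a scattered subword, so that ëᵢ and f̈ᵢ
-- are undefined on uvw, uwv and wuv alike.  Or every letter of uv has εᵢ = φᵢ = 0 (otherwise ëᵢ or
-- f̈ᵢ would move uv), and such letters are invisible to the i-structure wherever they are inserted.
-- Either way the i-structure of uvw, uwv and wuv is read off from w, so the components of these
-- three words are images of one and the same set of words w', matched through w'.
module Submission where

open import Defs
open import Data.Bool using (Bool; true; false; T; _∨_; _∧_; if_then_else_)
open import Data.Bool.Properties
  using (∨-assoc; ∨-identityʳ; ∨-zeroʳ; ∨-conicalˡ; ∨-conicalʳ; if-float; if-cong; if-cong-else; T-∨; T-∧)
open import Data.Empty using (⊥-elim)
open import Data.Integer as ℤ using (-[1+_]; 0ℤ)
import Data.Integer.Properties as ℤP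
open import Data.List using (List; []; _∷_; _++_; length; take; drop)
open import Data.List.Properties using (++-identityʳ; ++-assoc; length-++; ∷-injectiveˡ; ∷-injectiveʳ)
open import Data.List.Relation.Unary.All as All using (All; []; _∷_)
open import Data.List.Relation.Unary.All.Properties using (++⁻ˡ; ++⁻ʳ)
open import Data.List.Relation.Binary.Sublist.Propositional using (_⊆_; []; _∷_; _∷ʳ_; ⊆-refl)
open import Data.List.Relation.Binary.Sublist.Propositional.Properties using (++⁺; ++⁺ˡ; ++⁺ʳ)
open import Data.Maybe as Maybe using (Maybe; just; nothing; _>>=_; Is-just; is-just)
open import Data.Maybe.Properties using (map-∘; map-id; map-cong)
open import Data.Nat using (ℕ; zero; suc; _+_; _∸_; _<_; _<ᵇ_; z<s; s<s)
open import Data.Nat.Properties using (m+n∸n≡m)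
open import Data.Product as Product using (Σ; _×_; _,_; proj₁; proj₂)
open import Data.Sum as Sum using (_⊎_; inj₁; inj₂)
open import Data.Vec.Properties using (zipWith-assoc; zipWith-comm; zipWith-identityˡ)
open import Function using (_∘_; Equivalence)
open import Relation.Binary.PropositionalEquality

open Equivalence using (to; from)

if-true : ∀ {A : Set} {b} {x y : A} → T b → (if b then x else y) ≡ x
if-true {b = true} _ = refl

+-<ᵇ-cancelˡ : ∀ n {p q} → ((n + p) <ᵇ (n + q)) ≡ (p <ᵇ q)
+-<ᵇ-cancelˡ zero    = refl
+-<ᵇ-cancelˡ (suc n) = +-<ᵇ-cancelˡ n

drop-length-++ : ∀ {A : Set} (p w : List A) → drop (length p) (p ++ w) ≡ w
drop-length-++ []      w = refl
drop-length-++ (_ ∷ p) w = drop-length-++ p w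

take-length-++ : ∀ {A : Set} (w s : List A) → take (length w) (w ++ s) ≡ w
take-length-++ []      s = refl
take-length-++ (y ∷ w) s = cong (y ∷_) (take-length-++ w s)

stripSuffix : ∀ {A : Set} → ℕ → List A → List A
stripSuffix n y = take (length y ∸ n) y

stripSuffix-++ : ∀ {A : Set} (w s : List A) → stripSuffix (length s) (w ++ s) ≡ w
stripSuffix-++ w s = begin
  take (length (w ++ s) ∸ length s) (w ++ s)     ≡⟨ cong (λ n → take (n ∸ length s) (w ++ s)) (length-++ w) ⟩
  take (length w + length s ∸ length s) (w ++ s) ≡⟨ cong (λ n → take n (w ++ s)) (m+n∸n≡m (length w) (length s)) ⟩
  take (length w) (w ++ s)                       ≡⟨ take-length-++ w s ⟩
  w                                              ∎
  where open ≡-Reasoning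

module _ {D : RootDatum} (QC : QuasiCrystal D) where
  open RootDatum D
  open QuasiCrystal QC

  private variable
    P R : Q → Bool
    g   : Q → Maybe Q
    k   : ℕ
    y   : Q
    x N : Word QC

  Avoids : (Q → Bool) → Word QC → Set
  Avoids P = All (λ y → P y ≡ false)

  Moves : (Q → Maybe Q) → Q → Set
  Moves g y = Σ Q λ y' → g y ≡ just y' × y' ≢ y

  anyB-++ : ∀ x → anyB QC P (x ++ N) ≡ anyB QC P x ∨ anyB QC P N
  anyB-++         []      = refl
  anyB-++ {P} {N} (y ∷ x) = trans (cong (P y ∨_) (anyB-++ x)) (sym (∨-assoc (P y) _ _))

  avoids⇒anyB-false : Avoids P N → anyB QC P N ≡ false
  avoids⇒anyB-false []       = refl
  avoids⇒anyB-false (p ∷ ps) rewrite p = avoids⇒anyB-false ps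

  anyB-false⇒avoids : ∀ x → anyB QC P x ≡ false → Avoids P x
  anyB-false⇒avoids     []      _ = []
  anyB-false⇒avoids {P} (y ∷ x) h = ∨-conicalˡ (P y) _ h ∷ anyB-false⇒avoids x (∨-conicalʳ (P y) _ h)

  is-just-lastIdx : ∀ x → is-just (lastIdx QC P x) ≡ anyB QC P x
  is-just-lastIdx     []      = refl
  is-just-lastIdx {P} (y ∷ x) with lastIdx QC P x | is-just-lastIdx {P} x
  ... | just _  | h = sym (trans (cong (P y ∨_) (sym h)) (∨-zeroʳ (P y)))
  ... | nothing | h with P y
  ...   | true  = refl
  ...   | false = h

  avoids⇒lastIdx-nothing : Avoids P N → lastIdx QC P N ≡ nothing
  avoids⇒lastIdx-nothing []       = refl
  avoids⇒lastIdx-nothing (p ∷ ps) rewrite avoids⇒lastIdx-nothing ps | p = refl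

  lastIdx-nothing⇒avoids : ∀ x → lastIdx QC P x ≡ nothing → Avoids P x
  lastIdx-nothing⇒avoids x eq = anyB-false⇒avoids x (trans (sym (is-just-lastIdx x)) (cong is-just eq))

  lastIdx-++ˡ : Avoids P N → lastIdx QC P (N ++ x) ≡ Maybe.map (length N +_) (lastIdx QC P x)
  lastIdx-++ˡ               []       = sym (map-id _)
  lastIdx-++ˡ {P} {x = x} (p ∷ ps) rewrite lastIdx-++ˡ {x = x} ps with lastIdx QC P x
  ... | just _  = refl
  ... | nothing rewrite p = refl

  lastIdx-++ʳ : Avoids P N → ∀ x → lastIdx QC P (x ++ N) ≡ lastIdx QC P x
  lastIdx-++ʳ ps []      = avoids⇒lastIdx-nothing ps
  lastIdx-++ʳ ps (y ∷ x) rewrite lastIdx-++ʳ ps x = refl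

  lastIdx-< : ∀ x → lastIdx QC P x ≡ just k → k < length x
  lastIdx-< {P} (y ∷ x) eq with lastIdx QC P x in eq'
  ... | just _ with refl ← eq = s<s (lastIdx-< x eq')
  ... | nothing with P y | eq
  ...   | true | refl = z<s

  updateAt-lastIdx-moves : All (λ y → P y ≡ true → Moves g y) x → lastIdx QC P x ≡ just k →
                           Σ (Word QC) λ x' → updateAt QC k g x ≡ just x' × x' ≢ x
  updateAt-lastIdx-moves {P} {x = y ∷ x} (m ∷ ms) eq with lastIdx QC P x in eq'
  ... | just _ with refl ← eq with updateAt-lastIdx-moves ms eq'
  ...   | x' , up , x'≢x = y ∷ x' , cong (Maybe.map (y ∷_)) up , x'≢x ∘ ∷-injectiveʳ
  updateAt-lastIdx-moves {P} {x = y ∷ x} (m ∷ ms) eq | nothing with P y | m | eq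
  ...   | true | m' | refl with m' refl
  ...     | y' , gy , y'≢y = y' ∷ x , cong (Maybe.map (_∷ x)) gy , y'≢y ∘ ∷-injectiveˡ

  avoids⇒firstIdx-nothing : Avoids P N → firstIdx QC P N ≡ nothing
  avoids⇒firstIdx-nothing []       = refl
  avoids⇒firstIdx-nothing (p ∷ ps) rewrite p | avoids⇒firstIdx-nothing ps = refl

  firstIdx-nothing⇒avoids : ∀ x → firstIdx QC P x ≡ nothing → Avoids P x
  firstIdx-nothing⇒avoids     []      _  = []
  firstIdx-nothing⇒avoids {P} (y ∷ x) eq with P y in py | eq
  ... | false | eq₁ with firstIdx QC P x in eq' | eq₁
  ...   | nothing | _ = py ∷ firstIdx-nothing⇒avoids x eq'

  firstIdx-++ˡ : Avoids P N → firstIdx QC P (N ++ x) ≡ Maybe.map (length N +_) (firstIdx QC P x)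
  firstIdx-++ˡ               []       = sym (map-id _)
  firstIdx-++ˡ {P} {x = x} (p ∷ ps) rewrite p | firstIdx-++ˡ {x = x} ps = sym (map-∘ (firstIdx QC P x))

  firstIdx-++ʳ : Avoids P N → ∀ x → firstIdx QC P (x ++ N) ≡ firstIdx QC P x
  firstIdx-++ʳ ps []      = avoids⇒firstIdx-nothing ps
  firstIdx-++ʳ ps (y ∷ x) rewrite firstIdx-++ʳ ps x = refl

  firstIdx-< : ∀ x → firstIdx QC P x ≡ just k → k < length x
  firstIdx-< {P} (y ∷ x) eq with P y | eq
  ... | true  | refl = z<s
  ... | false | eq₁ with firstIdx QC P x in eq' | eq₁
  ...   | just _ | refl = s<s (firstIdx-< x eq')

  updateAt-firstIdx-moves : All (λ y → P y ≡ true → Moves g y) x → firstIdx QC P x ≡ just k →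
                            Σ (Word QC) λ x' → updateAt QC k g x ≡ just x' × x' ≢ x
  updateAt-firstIdx-moves {P} {x = y ∷ x} (m ∷ ms) eq with P y | m | eq
  ... | true | m' | refl with m' refl
  ...   | y' , gy , y'≢y = y' ∷ x , cong (Maybe.map (_∷ x)) gy , y'≢y ∘ ∷-injectiveˡ
  updateAt-firstIdx-moves {P} {x = y ∷ x} (m ∷ ms) eq | false | _ | eq₁ with firstIdx QC P x in eq' | eq₁
  ...   | just _ | refl with updateAt-firstIdx-moves ms eq'
  ...     | x' , up , x'≢x = y ∷ x' , cong (Maybe.map (y ∷_)) up , x'≢x ∘ ∷-injectiveʳ

  updateAt-++ˡ : ∀ N → updateAt QC (length N + k) g (N ++ x) ≡ Maybe.map (N ++_) (updateAt QC k g x)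
  updateAt-++ˡ               []      = sym (map-id _)
  updateAt-++ˡ {k} {g} {x} (n ∷ N) =
    trans (cong (Maybe.map (n ∷_)) (updateAt-++ˡ N)) (sym (map-∘ (updateAt QC k g x)))

  updateAt-++ʳ : ∀ x → k < length x → updateAt QC k g (x ++ N) ≡ Maybe.map (_++ N) (updateAt QC k g x)
  updateAt-++ʳ {k = zero}  {g} (y ∷ x) z<s     = map-∘ (g y)
  updateAt-++ʳ {k = suc k} {g} (y ∷ x) (s<s h) =
    trans (cong (Maybe.map (y ∷_)) (updateAt-++ʳ x h))
          (trans (sym (map-∘ (updateAt QC k g x))) (map-∘ (updateAt QC k g x)))

  updateAtIdx : Maybe ℕ → (Q → Maybe Q) → Word QC → Maybe (Word QC)
  updateAtIdx m g x = m >>= λ k → updateAt QC k g x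

  -- eW QC i and fW QC i are, by definition, guardedUpdate (badW QC i) (pIdx QC i) (e i)
  -- and guardedUpdate (badW QC i) (qIdx QC i) (f i).
  guardedUpdate : (Word QC → Bool) → (Word QC → Maybe ℕ) → (Q → Maybe Q) → Word QC → Maybe (Word QC)
  guardedUpdate bad idx g w = if bad w then nothing else updateAtIdx (idx w) g w

  guardedUpdate-++ˡ : ∀ bad idx g N x → bad (N ++ x) ≡ bad x → idx (N ++ x) ≡ Maybe.map (length N +_) (idx x) →
                      guardedUpdate bad idx g (N ++ x) ≡ Maybe.map (N ++_) (guardedUpdate bad idx g x)
  guardedUpdate-++ˡ bad idx g N x hb hi rewrite hb | hi =
    trans (if-cong-else (bad x) (shift (idx x))) (sym (if-float (Maybe.map (N ++_)) (bad x)))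
    where
    shift : ∀ m → updateAtIdx (Maybe.map (length N +_) m) g (N ++ x) ≡ Maybe.map (N ++_) (updateAtIdx m g x)
    shift nothing  = refl
    shift (just k) = updateAt-++ˡ N

  guardedUpdate-++ʳ : ∀ bad idx g x N → bad (x ++ N) ≡ bad x → idx (x ++ N) ≡ idx x →
                      (∀ {k} → idx x ≡ just k → k < length x) →
                      guardedUpdate bad idx g (x ++ N) ≡ Maybe.map (_++ N) (guardedUpdate bad idx g x)
  guardedUpdate-++ʳ bad idx g x N hb hi bound rewrite hb | hi =
    trans (if-cong-else (bad x) (extend (idx x) bound)) (sym (if-float (Maybe.map (_++ N)) (bad x)))
    where
    extend : ∀ m → (∀ {k} → m ≡ just k → k < length x) →
             updateAtIdx m g (x ++ N) ≡ Maybe.map (_++ N) (updateAtIdx m g x)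
    extend nothing  _     = refl
    extend (just k) bound = updateAt-++ʳ x (bound refl)

  -- The infinite case of the tensor rule

  occursBefore : (Q → Bool) → (Q → Bool) → Word QC → Bool
  occursBefore R P []      = false
  occursBefore R P (y ∷ x) = (R y ∧ anyB QC P x) ∨ occursBefore R P x

  gtM-shift : ∀ n a b → gtM QC (Maybe.map (n +_) a) (Maybe.map (n +_) b) ≡ gtM QC a b
  gtM-shift n nothing  b        = refl
  gtM-shift n (just p) nothing  = refl
  gtM-shift n (just p) (just q) = +-<ᵇ-cancelˡ n

  gtM-0 : ∀ m → gtM QC (just 0) m ≡ false
  gtM-0 nothing  = refl
  gtM-0 (just q) = refl

  -- The condition p > q of badW, recast so that it is visibly monotone under sublists.
  gtM-lastIdx-firstIdx : ∀ x → gtM QC (lastIdx QC P x) (firstIdx QC R x) ≡ occursBefore R P x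
  gtM-lastIdx-firstIdx         []      = refl
  gtM-lastIdx-firstIdx {P} {R} (y ∷ x)
    with lastIdx QC P x | is-just-lastIdx {P} x | gtM-lastIdx-firstIdx {P} {R} x
  ... | just k  | any | ih rewrite sym any with R y
  ...   | true  = refl
  ...   | false = trans (gtM-shift 1 (just k) (firstIdx QC R x)) ih
  gtM-lastIdx-firstIdx {P} {R} (y ∷ x) | nothing | any | ih rewrite sym any | sym ih with R y | P y
  ...   | true  | true  = refl
  ...   | true  | false = refl
  ...   | false | true  = gtM-0 (Maybe.map suc (firstIdx QC R x))
  ...   | false | false = refl

  anyB-mono : x ⊆ N → T (anyB QC P x) → T (anyB QC P N)
  anyB-mono []         t = t
  anyB-mono (_ ∷ʳ s)   t = T-∨ .from (inj₂ (anyB-mono s t))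
  anyB-mono (refl ∷ s) t = T-∨ .from (Sum.map₂ (anyB-mono s) (T-∨ .to t))

  occursBefore-mono : x ⊆ N → T (occursBefore R P x) → T (occursBefore R P N)
  occursBefore-mono []         t = t
  occursBefore-mono (_ ∷ʳ s)   t = T-∨ .from (inj₂ (occursBefore-mono s t))
  occursBefore-mono (refl ∷ s) t = T-∨ .from (Sum.map
    (λ ra → T-∧ .from (Product.map₂ (anyB-mono s) (T-∧ .to ra))) (occursBefore-mono s) (T-∨ .to t))

  badW-mono : ∀ i → x ⊆ N → T (badW QC i x) → T (badW QC i N)
  badW-mono {x} {N} i s = T-∨ .from ∘ Sum.map (anyB-mono s) gtM-mono ∘ T-∨ .to
    where
    gtM-mono : T (gtM QC (pIdx QC i x) (qIdx QC i x)) → T (gtM QC (pIdx QC i N) (qIdx QC i N))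
    gtM-mono t = subst T (sym (gtM-lastIdx-firstIdx N))
                   (occursBefore-mono s (subst T (gtM-lastIdx-firstIdx x) t))

  -- Neutral letters

  0⊕ : ∀ a → fin 0ℤ ⊕ a ≡ a
  0⊕ (fin b) = cong fin (ℤP.+-identityˡ b)
  0⊕ +∞      = refl
  0⊕ -∞      = refl

  module _ {h : Q → ℤ∞} (s : Word QC → ℤ∞) (s-∷ : ∀ y x → s (y ∷ x) ≡ h y ⊕ s x) where
    sum-++ˡ : All (λ y → h y ≡ fin 0ℤ) N → s (N ++ x) ≡ s x
    sum-++ˡ             []       = refl
    sum-++ˡ {y ∷ N} {x} (z ∷ zs) = trans (s-∷ y (N ++ x)) (trans (cong₂ _⊕_ z (sum-++ˡ zs)) (0⊕ (s x)))

    sum-++ʳ : All (λ y → h y ≡ fin 0ℤ) N → ∀ x → s (x ++ N) ≡ s x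
    sum-++ʳ {N} zs []      = trans (cong s (sym (++-identityʳ N))) (sum-++ˡ zs)
    sum-++ʳ {N} zs (y ∷ x) = trans (s-∷ y (x ++ N)) (trans (cong (h y ⊕_) (sum-++ʳ zs x)) (sym (s-∷ y x)))

  εPos φPos εInf : I → Q → Bool
  εPos i y = pos? (ε i y)
  φPos i y = pos? (φ i y)
  εInf i y = isPlusInf (ε i y)

  Neutral : I → Q → Set
  Neutral i y = ε i y ≡ fin 0ℤ × φ i y ≡ fin 0ℤ

  Commutes : (Word QC → Maybe (Word QC)) → (Word QC → Word QC) → Set
  Commutes op S = ∀ w → op (S w) ≡ Maybe.map S (op w)

  record Transparent (i : I) (S : Word QC → Word QC) : Set where
    field
      εW-∘        : ∀ w → εW QC i (S w) ≡ εW QC i w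
      φW-∘        : ∀ w → φW QC i (S w) ≡ φW QC i w
      eW-commutes : Commutes (eW QC i) S
      fW-commutes : Commutes (fW QC i) S

  transparent-∘ : ∀ {i S S'} → Transparent i S → Transparent i S' → Transparent i (S ∘ S')
  transparent-∘ {S = S} {S'} t t' = record
    { εW-∘        = λ w → trans (εW-∘ t (S' w)) (εW-∘ t' w)
    ; φW-∘        = λ w → trans (φW-∘ t (S' w)) (φW-∘ t' w)
    ; eW-commutes = commutes-∘ (eW QC _) (eW-commutes t) (eW-commutes t')
    ; fW-commutes = commutes-∘ (fW QC _) (fW-commutes t) (fW-commutes t')
    }
    where
    open Transparent
    commutes-∘ : ∀ op → Commutes op S → Commutes op S' → Commutes op (S ∘ S')
    commutes-∘ op c c' w = trans (c (S' w)) (trans (cong (Maybe.map S) (c' w)) (sym (map-∘ (op w))))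

  module NeutralWord {i : I} {N : Word QC} (neutral : All (Neutral i) N) where
    avoids-εPos : Avoids (εPos i) N
    avoids-εPos = All.map (cong pos? ∘ proj₁) neutral

    avoids-φPos : Avoids (φPos i) N
    avoids-φPos = All.map (cong pos? ∘ proj₂) neutral

    avoids-εInf : Avoids (εInf i) N
    avoids-εInf = All.map (cong isPlusInf ∘ proj₁) neutral

    badW-++ˡ : ∀ x → badW QC i (N ++ x) ≡ badW QC i x
    badW-++ˡ x = cong₂ _∨_
      (trans (anyB-++ N) (cong (_∨ anyB QC (εInf i) x) (avoids⇒anyB-false avoids-εInf)))
      (trans (cong₂ (gtM QC) (lastIdx-++ˡ avoids-εPos) (firstIdx-++ˡ avoids-φPos))
             (gtM-shift (length N) (pIdx QC i x) (qIdx QC i x)))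

    badW-++ʳ : ∀ x → badW QC i (x ++ N) ≡ badW QC i x
    badW-++ʳ x = cong₂ _∨_
      (trans (anyB-++ x) (trans (cong (anyB QC (εInf i) x ∨_) (avoids⇒anyB-false avoids-εInf)) (∨-identityʳ _)))
      (cong₂ (gtM QC) (lastIdx-++ʳ avoids-εPos x) (firstIdx-++ʳ avoids-φPos x))

    transparent-++ˡ : Transparent i (N ++_)
    transparent-++ˡ = record
      { εW-∘        = λ w → cong₂ (if_then +∞ else_) (badW-++ˡ w)
                              (sum-++ˡ (sumε QC i) (λ _ _ → refl) (All.map proj₁ neutral))
      ; φW-∘        = λ w → cong₂ (if_then +∞ else_) (badW-++ˡ w)
                              (sum-++ˡ (sumφ QC i) (λ _ _ → refl) (All.map proj₂ neutral))
      ; eW-commutes = λ w → guardedUpdate-++ˡ (badW QC i) (pIdx QC i) (e i) N w (badW-++ˡ w) (lastIdx-++ˡ avoids-εPos)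
      ; fW-commutes = λ w → guardedUpdate-++ˡ (badW QC i) (qIdx QC i) (f i) N w (badW-++ˡ w) (firstIdx-++ˡ avoids-φPos)
      }

    transparent-++ʳ : Transparent i (_++ N)
    transparent-++ʳ = record
      { εW-∘        = λ w → cong₂ (if_then +∞ else_) (badW-++ʳ w)
                              (sum-++ʳ (sumε QC i) (λ _ _ → refl) (All.map proj₁ neutral) w)
      ; φW-∘        = λ w → cong₂ (if_then +∞ else_) (badW-++ʳ w)
                              (sum-++ʳ (sumφ QC i) (λ _ _ → refl) (All.map proj₂ neutral) w)
      ; eW-commutes = λ w → guardedUpdate-++ʳ (badW QC i) (pIdx QC i) (e i) w N (badW-++ʳ w)
                              (lastIdx-++ʳ avoids-εPos w) (lastIdx-< w)
      ; fW-commutes = λ w → guardedUpdate-++ʳ (badW QC i) (qIdx QC i) (f i) w N (badW-++ʳ w)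
                              (firstIdx-++ʳ avoids-φPos w) (firstIdx-< w)
      }

  -- Isolated words under seminormality

  unmoved-avoids : ∀ m → (m ≡ nothing → Avoids P x) →
                   (∀ {k} → m ≡ just k → Σ (Word QC) λ x' → updateAt QC k g x ≡ just x' × x' ≢ x) →
                   (∀ x' → updateAtIdx m g x ≡ just x' → x' ≡ x) → Avoids P x
  unmoved-avoids nothing  none _     _     = none refl
  unmoved-avoids (just k) _    moves fixed with moves refl
  ... | x' , up , x'≢x = ⊥-elim (x'≢x (fixed x' up))

  decrement-moves : ∀ (h : Q → ℤ∞) (g : Q → Maybe Q) y k →
                    (∀ y' → g y ≡ just y' → h y' ≡ h y ⊞ -[1+ 0 ]) →
                    h y ≡ fin (ℤ.+ k) → Is-just (iter k g y) → pos? (h y) ≡ true → Moves g y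
  decrement-moves h g y zero    _   hk _   pos with trans (sym (cong pos? hk)) pos
  ... | ()
  decrement-moves h g y (suc k) law hk isj _   with g y | isj | law
  ... | just y' | _ | law' = y' , refl , moved (law' y' refl)
    where
    -- y' = y would give fin (+ suc k) ≡ fin (+ k)
    moved : h y' ≡ h y ⊞ -[1+ 0 ] → y' ≢ y
    moved step refl with trans (sym hk) (trans step (cong (_⊞ -[1+ 0 ]) hk))
    ... | ()

  εInf-false⇒≢+∞ : ∀ {i} → εInf i y ≡ false → ε i y ≢ +∞
  εInf-false⇒≢+∞ finite eq with trans (sym (cong isPlusInf eq)) finite
  ... | ()

  nonpositive⇒zero : ∀ {a} → a ≡ fin (ℤ.+ k) → pos? a ≡ false → a ≡ fin 0ℤ
  nonpositive⇒zero {zero}  ha _  = ha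
  nonpositive⇒zero {suc k} ha np with trans (sym (cong pos? ha)) np
  ... | ()

  module _ (seminormal : Seminormal QC) (i : I) where
    e-moves : εInf i y ≡ false → εPos i y ≡ true → Moves (e i) y
    e-moves {y} finite pos with seminormal i y (εInf-false⇒≢+∞ finite)
    ... | (k , hk , isj , _) , _ = decrement-moves (ε i) (e i) y k (e-ε i y) hk isj pos

    f-moves : εInf i y ≡ false → φPos i y ≡ true → Moves (f i) y
    f-moves {y} finite pos with seminormal i y (εInf-false⇒≢+∞ finite)
    ... | _ , (k , hk , isj , _) = decrement-moves (φ i) (f i) y k (f-φ i y) hk isj pos

    neutral-letter : εInf i y ≡ false → εPos i y ≡ false → φPos i y ≡ false → Neutral i y
    neutral-letter {y} finite εnp φnp with seminormal i y (εInf-false⇒≢+∞ finite)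
    ... | (_ , hk , _) , (_ , hk' , _) = nonpositive⇒zero hk εnp , nonpositive⇒zero hk' φnp

    -- A letter with εᵢ > 0 (resp. φᵢ > 0) would let ëᵢ (resp. f̈ᵢ) move the word.
    isolated-blocked-or-neutral : Isolated QC x → T (badW QC i x) ⊎ All (Neutral i) x
    isolated-blocked-or-neutral {x} isolated with badW QC i x in bad
    ... | true  = inj₁ _
    ... | false = inj₂ (All.zipWith (λ (a , b , c) → neutral-letter a b c) (finite , All.zip (εfree , φfree)))
      where
      finite : Avoids (εInf i) x
      finite = anyB-false⇒avoids x (∨-conicalˡ _ _ bad)

      εfree : Avoids (εPos i) x
      εfree = unmoved-avoids (pIdx QC i x) (lastIdx-nothing⇒avoids x)
        (updateAt-lastIdx-moves (All.map e-moves finite))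
        (λ x' up → isolated x' (via-e i here (trans (if-cong bad) up)))

      φfree : Avoids (φPos i) x
      φfree = unmoved-avoids (qIdx QC i x) (firstIdx-nothing⇒avoids x)
        (updateAt-firstIdx-moves (All.map f-moves finite))
        (λ x' up → isolated x' (via-f i here (trans (if-cong bad) up)))

  -- Isomorphisms of components induced by contexts

  Blocked : I → (Word QC → Word QC) → Set
  Blocked i S = ∀ w → T (badW QC i (S w))

  IndexAlike : I → (Word QC → Word QC) → (Word QC → Word QC) → Set
  IndexAlike i X Y = (Blocked i X × Blocked i Y) ⊎ (Transparent i X × Transparent i Y)

  Kills : (Word QC → Maybe (Word QC)) → (Word QC → Word QC) → Set
  Kills op S = ∀ w → op (S w) ≡ nothing

  OpAlike : (Word QC → Maybe (Word QC)) → (Word QC → Word QC) → (Word QC → Word QC) → Set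
  OpAlike op X Y = (Kills op X × Kills op Y) ⊎ (Commutes op X × Commutes op Y)

  module _ {X Y : Word QC → Word QC} where
    indexAlike-sym : ∀ {i} → IndexAlike i X Y → IndexAlike i Y X
    indexAlike-sym = Sum.map Product.swap Product.swap

    indexAlike-εW : ∀ {i} → IndexAlike i X Y → ∀ w → εW QC i (Y w) ≡ εW QC i (X w)
    indexAlike-εW (inj₁ (bx , by)) w = trans (if-true (by w)) (sym (if-true (bx w)))
    indexAlike-εW (inj₂ (tx , ty)) w = trans (Transparent.εW-∘ ty w) (sym (Transparent.εW-∘ tx w))

    indexAlike-φW : ∀ {i} → IndexAlike i X Y → ∀ w → φW QC i (Y w) ≡ φW QC i (X w)
    indexAlike-φW (inj₁ (bx , by)) w = trans (if-true (by w)) (sym (if-true (bx w)))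
    indexAlike-φW (inj₂ (tx , ty)) w = trans (Transparent.φW-∘ ty w) (sym (Transparent.φW-∘ tx w))

    indexAlike-eW : ∀ {i} → IndexAlike i X Y → OpAlike (eW QC i) X Y
    indexAlike-eW = Sum.map (Product.map (λ b → if-true ∘ b) (λ b → if-true ∘ b))
                            (Product.map Transparent.eW-commutes Transparent.eW-commutes)

    indexAlike-fW : ∀ {i} → IndexAlike i X Y → OpAlike (fW QC i) X Y
    indexAlike-fW = Sum.map (Product.map (λ b → if-true ∘ b) (λ b → if-true ∘ b))
                            (Product.map Transparent.fW-commutes Transparent.fW-commutes)

    opAlike-step : ∀ op {w x} → OpAlike op X Y → op (X w) ≡ just x →
                   Σ (Word QC) λ w' → x ≡ X w' × op (Y w) ≡ just (Y w')
    opAlike-step op {w} (inj₁ (kx , _)) eq with trans (sym (kx w)) eq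
    ... | ()
    opAlike-step op {w} (inj₂ (cx , cy)) eq with op w | trans (sym (cx w)) eq | cy w
    ... | just w' | refl | cyw = w' , refl , cyw

    opAlike-map : ∀ op {r : Word QC → Word QC} → OpAlike op X Y → (∀ w → r (X w) ≡ w) →
                  ∀ w → op (Y w) ≡ Maybe.map (Y ∘ r) (op (X w))
    opAlike-map op (inj₁ (kx , ky)) _ w = trans (ky w) (sym (cong (Maybe.map _) (kx w)))
    opAlike-map op {r} (inj₂ (cx , cy)) r∘X w = begin
      op (Y w)                               ≡⟨ cy w ⟩
      Maybe.map Y (op w)                     ≡⟨ map-cong (λ w' → cong Y (sym (r∘X w'))) (op w) ⟩
      Maybe.map (Y ∘ r ∘ X) (op w)           ≡⟨ map-∘ (op w) ⟩
      Maybe.map (Y ∘ r) (Maybe.map X (op w)) ≡⟨ cong (Maybe.map (Y ∘ r)) (cx w) ⟨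
      Maybe.map (Y ∘ r) (op (X w))           ∎
      where open ≡-Reasoning

    reach-transfer : (∀ i → IndexAlike i X Y) → ∀ {w x} → Reach QC (X w) x →
                     Σ (Word QC) λ w' → x ≡ X w' × Reach QC (Y w) (Y w')
    reach-transfer alike here = _ , refl , here
    reach-transfer alike (via-e i r eq) with reach-transfer alike r
    ... | _ , refl , r' with opAlike-step (eW QC i) (indexAlike-eW (alike i)) eq
    ...   | w' , refl , eq' = w' , refl , via-e i r' eq'
    reach-transfer alike (via-f i r eq) with reach-transfer alike r
    ... | _ , refl , r' with opAlike-step (fW QC i) (indexAlike-fW (alike i)) eq
    ...   | w' , refl , eq' = w' , refl , via-f i r' eq'

  module _ {X Y : Word QC → Word QC} (alike : ∀ i → IndexAlike i X Y)
           (wt-≡ : ∀ w → wtW QC (Y w) ≡ wtW QC (X w))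
           (r r' : Word QC → Word QC) (r∘X : ∀ w → r (X w) ≡ w) (r'∘Y : ∀ w → r' (Y w) ≡ w) where

    private
      on-component : ∀ {w} (P : Word QC → Set) → (∀ w' → P (X w')) → ∀ x → Reach QC (X w) x → P x
      on-component P h x reach with reach-transfer alike reach
      ... | w' , refl , _ = h w'

      Y∘r∘X : ∀ w → Y (r (X w)) ≡ Y w
      Y∘r∘X = cong Y ∘ r∘X

      X∘r'∘Y : ∀ w → X (r' (Y w)) ≡ X w
      X∘r'∘Y = cong X ∘ r'∘Y

    componentIso : ∀ w → IsCompIso QC (X w) (Y w) (Y ∘ r)
    componentIso w = record
      { ψ⁻¹     = X ∘ r'
      ; into    = λ _ → into
      ; into⁻¹  = λ _ → into⁻¹
      ; inv-l   = on-component _ λ w' → trans (cong (X ∘ r') (Y∘r∘X w')) (X∘r'∘Y w')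
      ; inv-r   = λ _ → inv-r
      ; base    = Y∘r∘X w
      ; pres-wt = on-component _ λ w' → trans (cong (wtW QC) (Y∘r∘X w')) (wt-≡ w')
      ; pres-ε  = λ i → on-component _ λ w' →
                    trans (cong (εW QC i) (Y∘r∘X w')) (indexAlike-εW (alike i) w')
      ; pres-φ  = λ i → on-component _ λ w' →
                    trans (cong (φW QC i) (Y∘r∘X w')) (indexAlike-φW (alike i) w')
      ; pres-e  = λ i → on-component _ λ w' →
                    trans (cong (eW QC i) (Y∘r∘X w')) (opAlike-map (eW QC i) (indexAlike-eW (alike i)) r∘X w')
      ; pres-f  = λ i → on-component _ λ w' →
                    trans (cong (fW QC i) (Y∘r∘X w')) (opAlike-map (fW QC i) (indexAlike-fW (alike i)) r∘X w')
      }
      where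
      into : ∀ {x} → Reach QC (X w) x → Reach QC (Y w) (Y (r x))
      into reach with reach-transfer alike reach
      ... | w' , refl , reach' = subst (Reach QC (Y w)) (sym (Y∘r∘X w')) reach'

      into⁻¹ : ∀ {y} → Reach QC (Y w) y → Reach QC (X w) (X (r' y))
      into⁻¹ reach with reach-transfer (indexAlike-sym ∘ alike) reach
      ... | w' , refl , reach' = subst (Reach QC (X w)) (sym (X∘r'∘Y w')) reach'

      inv-r : ∀ {y} → Reach QC (Y w) y → Y (r (X (r' y))) ≡ y
      inv-r reach with reach-transfer (indexAlike-sym ∘ alike) reach
      ... | w' , refl , _ = trans (cong (Y ∘ r) (X∘r'∘Y w')) (Y∘r∘X w')

  module _ (seminormal : Seminormal QC) (u v : Word QC) (isolated : Isolated QC (u ++ v)) where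
    isolated-contexts-alike : ∀ {X Y : Word QC → Word QC} →
      (∀ {i} → All (Neutral i) (u ++ v) → Transparent i X) →
      (∀ {i} → All (Neutral i) (u ++ v) → Transparent i Y) →
      (∀ w → u ++ v ⊆ X w) → (∀ w → u ++ v ⊆ Y w) → ∀ i → IndexAlike i X Y
    isolated-contexts-alike tX tY ⊆X ⊆Y i with isolated-blocked-or-neutral seminormal i isolated
    ... | inj₁ blocked = inj₁ ((λ w → badW-mono i (⊆X w) blocked) , (λ w → badW-mono i (⊆Y w) blocked))
    ... | inj₂ neutral = inj₂ (tX neutral , tY neutral)

  wtW-++ : ∀ a b → wtW QC (a ++ b) ≡ wtW QC a +Λ wtW QC b
  wtW-++ []      b = sym (zipWith-identityˡ ℤP.+-identityˡ (wtW QC b))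
  wtW-++ (y ∷ a) b = trans (cong (wt y +Λ_) (wtW-++ a b)) (sym (zipWith-assoc ℤP.+-assoc (wt y) _ _))

  wtW-++-comm : ∀ a b → wtW QC (a ++ b) ≡ wtW QC (b ++ a)
  wtW-++-comm a b = trans (wtW-++ a b) (trans (zipWith-comm ℤP.+-comm (wtW QC a) _) (sym (wtW-++ b a)))

  wtW-++-congˡ : ∀ a {b c} → wtW QC b ≡ wtW QC c → wtW QC (a ++ b) ≡ wtW QC (a ++ c)
  wtW-++-congˡ []      h = h
  wtW-++-congˡ (y ∷ a) h = cong (wt y +Λ_) (wtW-++-congˡ a h)

  module Contexts (u v : Word QC) where
    uvw uwv wuv uvw⁻¹ uwv⁻¹ wuv⁻¹ : Word QC → Word QC
    uvw w = u ++ v ++ w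
    uwv w = u ++ w ++ v
    wuv w = w ++ u ++ v
    uvw⁻¹ = drop (length v) ∘ drop (length u)
    uwv⁻¹ = stripSuffix (length v) ∘ drop (length u)
    wuv⁻¹ = stripSuffix (length (u ++ v))

    uvw⁻¹-uvw : ∀ w → uvw⁻¹ (uvw w) ≡ w
    uvw⁻¹-uvw w = trans (cong (drop (length v)) (drop-length-++ u (v ++ w))) (drop-length-++ v w)

    uwv⁻¹-uwv : ∀ w → uwv⁻¹ (uwv w) ≡ w
    uwv⁻¹-uwv w = trans (cong (stripSuffix (length v)) (drop-length-++ u (w ++ v))) (stripSuffix-++ w v)

    wuv⁻¹-wuv : ∀ w → wuv⁻¹ (wuv w) ≡ w
    wuv⁻¹-wuv w = stripSuffix-++ w (u ++ v)

    uv⊆uvw : ∀ w → u ++ v ⊆ uvw w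
    uv⊆uvw w = ++⁺ (⊆-refl {x = u}) (++⁺ʳ w ⊆-refl)

    uv⊆uwv : ∀ w → u ++ v ⊆ uwv w
    uv⊆uwv w = ++⁺ (⊆-refl {x = u}) (++⁺ˡ w ⊆-refl)

    uv⊆wuv : ∀ w → u ++ v ⊆ wuv w
    uv⊆wuv w = ++⁺ˡ w ⊆-refl

    wtW-uwv≡uvw : ∀ w → wtW QC (uwv w) ≡ wtW QC (uvw w)
    wtW-uwv≡uvw w = wtW-++-congˡ u (wtW-++-comm w v)

    wtW-wuv≡uwv : ∀ w → wtW QC (wuv w) ≡ wtW QC (uwv w)
    wtW-wuv≡uwv w = begin
      wtW QC (w ++ u ++ v)   ≡⟨ wtW-++-comm w (u ++ v) ⟩
      wtW QC ((u ++ v) ++ w) ≡⟨ cong (wtW QC) (++-assoc u v w) ⟩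
      wtW QC (u ++ v ++ w)   ≡⟨ wtW-uwv≡uvw w ⟨
      wtW QC (u ++ w ++ v)   ∎
      where open ≡-Reasoning

    module _ {i : I} (neutral : All (Neutral i) (u ++ v)) where
      open NeutralWord

      transparent-uvw : Transparent i uvw
      transparent-uvw = transparent-∘ (transparent-++ˡ (++⁻ˡ u neutral)) (transparent-++ˡ (++⁻ʳ u neutral))

      transparent-uwv : Transparent i uwv
      transparent-uwv = transparent-∘ (transparent-++ˡ (++⁻ˡ u neutral)) (transparent-++ʳ (++⁻ʳ u neutral))

      transparent-wuv : Transparent i wuv
      transparent-wuv = transparent-++ʳ neutral

theorem7p5 : (D : RootDatum) (QC : QuasiCrystal D) → Seminormal QC →
    (u v : Word QC) → Isolated QC (u ++ v) →
    (w : Word QC) →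
    _≈h_ QC (u ++ v ++ w) (u ++ w ++ v) × _≈h_ QC (u ++ w ++ v) (w ++ u ++ v)
theorem7p5 D QC seminormal u v isolated w =
    (_ , componentIso QC uvw∼uwv wtW-uwv≡uvw uvw⁻¹ uwv⁻¹ uvw⁻¹-uvw uwv⁻¹-uwv w)
  , (_ , componentIso QC uwv∼wuv wtW-wuv≡uwv uwv⁻¹ wuv⁻¹ uwv⁻¹-uwv wuv⁻¹-wuv w)
  where
  open Contexts QC u v

  uvw∼uwv : ∀ i → IndexAlike QC i uvw uwv
  uvw∼uwv = isolated-contexts-alike QC seminormal u v isolated transparent-uvw transparent-uwv uv⊆uvw uv⊆uwv

  uwv∼wuv : ∀ i → IndexAlike QC i uwv wuv
  uwv∼wuv = isolated-contexts-alike QC seminormal u v isolated transparent-uwv transparent-wuv uv⊆uwv uv⊆wuv
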